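{- Let $A\in\{0,\pm1\}^{r\times n}$ and let $X=\mathrm{diag}(z_i:i\in[n])$ be a diagonal matrix of rational functions. Let $A_r$ denote the $r$-th row of $A$, $N_1:=\mathrm{supp}(A_r)$, $N_0:=[n]\setminus N_1$, and $y:=\sum_{i\in N_1}z_i$. Let $A'\in\mathbb{R}^{(r-1)\times n'}$, $n':=|N_0|+\binom{|N_1|}{2}$, have columns indexed by $N_0\cup\binom{N_1}{2}$ with $A'_{i,j}:=A_{i,j}$ for $i\in[r-1]$, $j\in N_0$, and $A'_{i,(j,k)}:=A_{i,j}-A_{r,j}A_{r,k}A_{i,k}$ for $i\in[r-1]$ and $j,k\in N_1$ with $j<k$. Let $X'$ be the diagonal $n'\times n'$ matrix of rational functions with $X'_{i,i}:=z_i$ for $i\in N_0$ and $X'_{(\alpha,\beta),(\alpha,\beta)}:=z_\alpha z_\beta/y$ for $\alpha,\beta\in N_1$ with $\alpha<\beta$. Then $\det(AXA^\intercal)=y\cdot\det(A'X'A'^\intercal)$.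
   Context: The matrix $A'$ is called the star-mesh transformation of $A$ with respect to row $r$. Determinants are taken over the field of rational functions; $X'$ is defined only when $y\neq0$ or $N_1$ has fewer than two elements. -}

module Defs where

open import Level using (Level; _⊔_)
open import Relation.Binary.PropositionalEquality using (_≡_)
open import Algebra.Bundles using (CommutativeRing)
open import Data.Nat as ℕ using (ℕ; zero; suc)
open import Data.Integer as ℤ using (ℤ; +_; -[1+_])
open import Data.Fin as Fin using (Fin; zero; suc; toℕ; fromℕ; inject₁; punchIn; _<?_)
open import Data.Bool using (Bool; true; false; not; _∧_)
open import Data.List using (List; []; _∷_; _++_; map; concatMap; allFin; filterᵇ; foldr; length)
open import Data.Sum using (_⊎_; inj₁; inj₂)
open import Data.Product using (_×_; _,_)
open import Relation.Nullary using (¬_)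
open import Relation.Nullary.Decidable using (⌊_⌋)

-- A field: a commutative ring with a total inverse function (0⁻¹ is junk),
-- which is a genuine multiplicative inverse on nonzero elements, and 0 ≠ 1.
record Field (c ℓ : Level) : Set (Level.suc (c ⊔ ℓ)) where
  field
    commutativeRing : CommutativeRing c ℓ
  open CommutativeRing commutativeRing public
  field
    _⁻¹      : Carrier → Carrier
    ⁻¹-inverseʳ : ∀ x → ¬ (x ≈ 0#) → (x * (x ⁻¹)) ≈ 1#
    0≉1      : ¬ (0# ≈ 1#)

module FieldOps {c ℓ : Level} (F : Field c ℓ) where
  open Field F hiding (zero)

  fromℕ' : ℕ → Carrier
  fromℕ' zero = 0#
  fromℕ' (suc k) = 1# + fromℕ' k

  ι : ℤ → Carrier
  ι (+ k) = fromℕ' k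
  ι -[1+ k ] = - fromℕ' (suc k)

  CharZero : Set ℓ
  CharZero = ∀ k → ¬ (fromℕ' (suc k) ≈ 0#)

  Σ-list : ∀ {a} {I : Set a} → List I → (I → Carrier) → Carrier
  Σ-list is f = foldr (λ i acc → f i + acc) 0# is

  Σ-fin : ∀ n → (Fin n → Carrier) → Carrier
  Σ-fin n f = Σ-list (allFin n) f

  sgn : ℕ → Carrier
  sgn zero = 1#
  sgn (suc k) = - sgn k

  det : ∀ n → (Fin n → Fin n → Carrier) → Carrier
  det zero M = 1#
  det (suc n) M =
    Σ-fin (suc n) (λ j → sgn (toℕ j) * (M Fin.zero j * det n (λ a b → M (suc a) (punchIn j b))))

  AXAᵀ : ∀ {a} {Col : Set a} (r : ℕ) (cols : List Col)
         → (Fin r → Col → Carrier) → (Col → Carrier) → Fin r → Fin r → Carrier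
  AXAᵀ r cols A X i l = Σ-list cols (λ col → A i col * (X col * A l col))

  module StarMesh (m n : ℕ) (A : Fin (suc m) → Fin n → ℤ) (z : Fin n → Carrier) where
    -- the last (r-th, r = m+1) row
    rowR : Fin n → ℤ
    rowR = A (fromℕ m)

    inN1 : Fin n → Bool
    inN1 j = not ⌊ rowR j ℤ.≟ + 0 ⌋

    N1 : List (Fin n)
    N1 = filterᵇ inN1 (allFin n)

    N0 : List (Fin n)
    N0 = filterᵇ (λ j → not (inN1 j)) (allFin n)

    N1choose2 : List (Fin n × Fin n)
    N1choose2 = concatMap (λ j → map (λ k → (j , k)) (filterᵇ (λ k → ⌊ j <? k ⌋ ∧ inN1 k) N1)) N1

    -- column index set of A' : N0 ⊔ (N1 choose 2)
    Col' : Set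
    Col' = Fin n ⊎ (Fin n × Fin n)

    cols' : List Col'
    cols' = map inj₁ N0 ++ map inj₂ N1choose2

    y : Carrier
    y = Σ-list N1 z

    Aℤ : Fin (suc m) → Fin n → Carrier
    Aℤ i j = ι (A i j)

    A' : Fin m → Col' → Carrier
    A' i (inj₁ j) = ι (A (inject₁ i) j)
    A' i (inj₂ (j , k)) = ι (A (inject₁ i) j ℤ.- rowR j ℤ.* rowR k ℤ.* A (inject₁ i) k)

    X' : Col' → Carrier
    X' (inj₁ j) = z j
    X' (inj₂ (j , k)) = (z j * z k) * (y ⁻¹)

    lhs : Carrier
    lhs = det (suc m) (AXAᵀ (suc m) (allFin n) Aℤ z)

    rhs : Carrier
    rhs = y * det m (AXAᵀ m cols' A' X')

IsSignEntry : ℤ → Set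
IsSignEntry x = (x ≡ + 0) ⊎ ((x ≡ + 1) ⊎ (x ≡ -[1+ 0 ]))

module Submission where

-- The last row of A carries the entries ±1 on N₁ and 0 on N₀, so the corner entry of
-- M = A X Aᵀ is y. Adding μᵢ times the last row of M to row i preserves the determinant;
-- with μᵢ = −M_{ir}/y this clears the last column, giving det M = y · det S for the Schur
-- complement S_{il} = M_{il} − M_{ir} M_{rl}/y. The N₀ part of S is the N₀ part of A'X'A'ᵀ,
-- and the Cauchy–Binet formula for the 2 × 2 Gram determinant y·Σ aᵢ z aₗ − (Σ aᵢ z α)(Σ α z aₗ)
-- (α the last row, α² = 1 on N₁) turns the N₁ part into the sum over pairs j < k defining
-- A'X'A'ᵀ. If |N₁| < 2, y may vanish; then μᵢ = −Σ_{N₁} A_{ij} A_{rj} clears the column instead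
-- and both N₁ parts vanish. The determinant is given by Laplace expansion, and its invariance
-- under row operations is derived from alternation, obtained by swapping the first two rows;
-- this needs 2 ≠ 0, the only use of characteristic zero.

open import Defs
open import Level using (Level)
open import Data.Nat using (ℕ; zero; suc; _<_; s≤s)
import Data.Nat as ℕ
open import Data.Integer as ℤ using (ℤ; +_; -[1+_])
import Data.Integer.Properties as ℤ
open import Data.Maybe using (Maybe; just; nothing)
open import Data.Bool using (Bool; true; false; not; T; if_then_else_; _∧_)
open import Data.List using (List; []; _∷_; _++_; map; concatMap; allFin; filterᵇ; length)
open import Data.List.Properties using (map-tabulate)
open import Data.List.Relation.Unary.All as All using (All; []; _∷_)
open import Data.List.Relation.Unary.All.Properties using (all-filter)
open import Data.Fin as Fin using (Fin; zero; suc; punchIn; punchOut; inject₁; fromℕ; toℕ)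
import Data.Fin.Properties as Fin
open import Data.Product using (_×_; _,_)
open import Data.Sum using (_⊎_; inj₁; inj₂)
open import Data.Empty using (⊥-elim)
open import Function using (_∘_; id)
open import Relation.Nullary using (¬_; yes; no; T?)
open import Relation.Nullary.Decidable using (⌊_⌋)
open import Relation.Binary.Definitions using (tri<; tri≈; tri>)
open import Relation.Binary.PropositionalEquality as ≡ using (_≡_; _≢_)
open import Algebra.Solver.Ring.AlmostCommutativeRing
  using (AlmostCommutativeRing; fromCommutativeRing; _-Raw-AlmostCommutative⟶_)
import Algebra.Solver.Ring as RingSolver
import Algebra.Properties.Ring as RingProperties
import Algebra.Properties.Semiring.Mult as SemiringMult
import Algebra.Properties.CommutativeSemigroup as CommutativeSemigroupProperties

module Arithmetic {c ℓ : Level} (F : Field c ℓ) where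
  open FieldOps F
  open Field F hiding (zero)
  open RingProperties ring public
  open import Relation.Binary.Reasoning.Setoid setoid public
  open SemiringMult semiring using (×-homo-+; ×1-homo-*) renaming (_×_ to _×′_)
  open CommutativeSemigroupProperties +-commutativeSemigroup public using (interchange; x∙yz≈y∙xz)

  fromℕ'≡×1# : ∀ k → fromℕ' k ≡ k ×′ 1#
  fromℕ'≡×1# zero    = ≡.refl
  fromℕ'≡×1# (suc k) = ≡.cong (λ t → 1# + t) (fromℕ'≡×1# k)

  fromℕ'-+ : ∀ a b → fromℕ' (a ℕ.+ b) ≈ fromℕ' a + fromℕ' b
  fromℕ'-+ a b rewrite fromℕ'≡×1# (a ℕ.+ b) | fromℕ'≡×1# a | fromℕ'≡×1# b = ×-homo-+ 1# a b

  fromℕ'-* : ∀ a b → fromℕ' (a ℕ.* b) ≈ fromℕ' a * fromℕ' b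
  fromℕ'-* a b rewrite fromℕ'≡×1# (a ℕ.* b) | fromℕ'≡×1# a | fromℕ'≡×1# b = ×1-homo-* a b

  ι-neg : ∀ x → ι (ℤ.- x) ≈ - ι x
  ι-neg (+ zero)  = sym -0#≈0#
  ι-neg (+ suc n) = refl
  ι-neg -[1+ n ]  = sym (-‿involutive _)

  ι-⊖ : ∀ a b → ι (a ℤ.⊖ b) ≈ fromℕ' a - fromℕ' b
  ι-⊖ a       zero    = sym (trans (+-congˡ -0#≈0#) (+-identityʳ _))
  ι-⊖ zero    (suc b) = sym (+-identityˡ _)
  ι-⊖ (suc a) (suc b) = begin
    ι (suc a ℤ.⊖ suc b)                           ≡⟨ ≡.cong ι (ℤ.[1+m]⊖[1+n]≡m⊖n a b) ⟩
    ι (a ℤ.⊖ b)                                   ≈⟨ ι-⊖ a b ⟩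
    fromℕ' a - fromℕ' b                           ≈⟨ sym (+-identityˡ _) ⟩
    0# + (fromℕ' a - fromℕ' b)                    ≈⟨ +-congʳ (sym (-‿inverseʳ 1#)) ⟩
    (1# - 1#) + (fromℕ' a - fromℕ' b)             ≈⟨ interchange 1# (- 1#) (fromℕ' a) (- fromℕ' b) ⟩
    (1# + fromℕ' a) + (- 1# - fromℕ' b)           ≈⟨ +-congˡ (-‿+-comm 1# (fromℕ' b)) ⟩
    (1# + fromℕ' a) - (1# + fromℕ' b)             ∎

  ι-+ : ∀ x y → ι (x ℤ.+ y) ≈ ι x + ι y
  ι-+ (+ a)    (+ b)    = fromℕ'-+ a b
  ι-+ (+ a)    -[1+ b ] = ι-⊖ a (suc b)
  ι-+ -[1+ a ] (+ b)    = trans (ι-⊖ b (suc a)) (+-comm _ _)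
  ι-+ -[1+ a ] -[1+ b ] = begin
    - (1# + (1# + fromℕ' (a ℕ.+ b)))        ≈⟨ -‿cong (+-congˡ (+-congˡ (fromℕ'-+ a b))) ⟩
    - (1# + (1# + (fromℕ' a + fromℕ' b)))   ≈⟨ -‿cong (+-congˡ (sym (+-assoc 1# _ _))) ⟩
    - (1# + ((1# + fromℕ' a) + fromℕ' b))   ≈⟨ -‿cong (sym (+-assoc 1# _ _)) ⟩
    - ((1# + (1# + fromℕ' a)) + fromℕ' b)   ≈⟨ -‿cong (+-congʳ (+-comm 1# _)) ⟩
    - (((1# + fromℕ' a) + 1#) + fromℕ' b)   ≈⟨ -‿cong (+-assoc _ 1# _) ⟩
    - ((1# + fromℕ' a) + (1# + fromℕ' b))   ≈⟨ sym (-‿+-comm _ _) ⟩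
    - (1# + fromℕ' a) - (1# + fromℕ' b)     ∎

  ι-*-nonneg : ∀ a b → ι (+ a ℤ.* + b) ≈ ι (+ a) * ι (+ b)
  ι-*-nonneg a b rewrite ≡.sym (ℤ.pos-* a b) = fromℕ'-* a b

  ι-* : ∀ x y → ι (x ℤ.* y) ≈ ι x * ι y
  ι-* (+ a)    (+ b)    = ι-*-nonneg a b
  ι-* (+ a)    -[1+ b ] = begin
    ι (+ a ℤ.* ℤ.- + suc b)       ≡⟨ ≡.cong ι (≡.sym (ℤ.neg-distribʳ-* (+ a) (+ suc b))) ⟩
    ι (ℤ.- (+ a ℤ.* + suc b))     ≈⟨ ι-neg (+ a ℤ.* + suc b) ⟩
    - ι (+ a ℤ.* + suc b)         ≈⟨ -‿cong (ι-*-nonneg a (suc b)) ⟩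
    - (ι (+ a) * ι (+ suc b))     ≈⟨ -‿distribʳ-* _ _ ⟩
    ι (+ a) * ι -[1+ b ]          ∎
  ι-* -[1+ a ] (+ b)    = begin
    ι (ℤ.- + suc a ℤ.* + b)       ≡⟨ ≡.cong ι (≡.sym (ℤ.neg-distribˡ-* (+ suc a) (+ b))) ⟩
    ι (ℤ.- (+ suc a ℤ.* + b))     ≈⟨ ι-neg (+ suc a ℤ.* + b) ⟩
    - ι (+ suc a ℤ.* + b)         ≈⟨ -‿cong (ι-*-nonneg (suc a) b) ⟩
    - (ι (+ suc a) * ι (+ b))     ≈⟨ -‿distribˡ-* _ _ ⟩
    ι -[1+ a ] * ι (+ b)          ∎
  ι-* -[1+ a ] -[1+ b ] = begin
    ι (+ suc a ℤ.* + suc b)       ≈⟨ ι-*-nonneg (suc a) (suc b) ⟩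
    ι (+ suc a) * ι (+ suc b)     ≈⟨ sym (-‿involutive _) ⟩
    - - (ι (+ suc a) * ι (+ suc b)) ≈⟨ -‿cong (-‿distribˡ-* _ _) ⟩
    - (ι -[1+ a ] * ι (+ suc b))  ≈⟨ -‿distribʳ-* _ _ ⟩
    ι -[1+ a ] * ι -[1+ b ]       ∎

  1-x≈0 : ∀ {x} → x ≈ 1# → ι (+ 1) - x ≈ 0#
  1-x≈0 x≈1 = trans (+-cong (+-identityʳ 1#) (-‿cong x≈1)) (-‿inverseʳ 1#)

  almostCommutativeRing : AlmostCommutativeRing c ℓ
  almostCommutativeRing = fromCommutativeRing commutativeRing

  ι-homomorphism : ℤ.+-*-rawRing -Raw-AlmostCommutative⟶ almostCommutativeRing
  ι-homomorphism = record
    { ⟦_⟧ = ι ; +-homo = ι-+ ; *-homo = ι-* ; -‿homo = ι-neg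
    ; 0-homo = refl ; 1-homo = +-identityʳ 1# }

  ι-≈? : ∀ x y → Maybe (ι x ≈ ι y)
  ι-≈? x y with x ℤ.≟ y
  ... | yes ≡.refl = just refl
  ... | no _       = nothing

  open RingSolver ℤ.+-*-rawRing almostCommutativeRing ι-homomorphism ι-≈? public

module Sums {c ℓ : Level} (F : Field c ℓ) where
  open FieldOps F renaming (Σ-list to Σ)
  open Field F hiding (zero)
  open Arithmetic F

  private variable
    a b : Level
    I : Set a
    J : Set b

  Σ-cong : ∀ (xs : List I) {f g : I → Carrier} → (∀ x → f x ≈ g x) → Σ xs f ≈ Σ xs g
  Σ-cong []       f≈g = refl
  Σ-cong (x ∷ xs) f≈g = +-cong (f≈g x) (Σ-cong xs f≈g)

  Σ-cong-All : ∀ {xs : List I} {f g : I → Carrier} → All (λ x → f x ≈ g x) xs → Σ xs f ≈ Σ xs g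
  Σ-cong-All []           = refl
  Σ-cong-All (fx≈gx ∷ eqs) = +-cong fx≈gx (Σ-cong-All eqs)

  Σ-zero : ∀ (xs : List I) → Σ xs (λ _ → 0#) ≈ 0#
  Σ-zero []       = refl
  Σ-zero (x ∷ xs) = trans (+-identityˡ _) (Σ-zero xs)

  Σ-+ : ∀ (xs : List I) (f g : I → Carrier) → Σ xs (λ x → f x + g x) ≈ Σ xs f + Σ xs g
  Σ-+ []       f g = sym (+-identityˡ 0#)
  Σ-+ (x ∷ xs) f g = trans (+-congˡ (Σ-+ xs f g)) (solve 4 (λ a b c d → (a :+ b) :+ (c :+ d) := (a :+ c) :+ (b :+ d)) refl _ _ _ _)

  Σ-*ˡ : ∀ (xs : List I) (k : Carrier) (f : I → Carrier) → Σ xs (λ x → k * f x) ≈ k * Σ xs f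
  Σ-*ˡ []       k f = sym (zeroʳ k)
  Σ-*ˡ (x ∷ xs) k f = trans (+-congˡ (Σ-*ˡ xs k f)) (sym (distribˡ _ _ _))

  Σ-*ʳ : ∀ (xs : List I) (k : Carrier) (f : I → Carrier) → Σ xs (λ x → f x * k) ≈ Σ xs f * k
  Σ-*ʳ xs k f = trans (Σ-cong xs (λ x → *-comm _ _)) (trans (Σ-*ˡ xs k f) (*-comm _ _))

  Σ-neg : ∀ (xs : List I) (f : I → Carrier) → Σ xs (λ x → - f x) ≈ - Σ xs f
  Σ-neg []       f = sym -0#≈0#
  Σ-neg (x ∷ xs) f = trans (+-congˡ (Σ-neg xs f)) (-‿+-comm _ _)

  Σ-++ : ∀ (xs ys : List I) (f : I → Carrier) → Σ (xs ++ ys) f ≈ Σ xs f + Σ ys f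
  Σ-++ []       ys f = sym (+-identityˡ _)
  Σ-++ (x ∷ xs) ys f = trans (+-congˡ (Σ-++ xs ys f)) (sym (+-assoc _ _ _))

  Σ-comm : ∀ (xs : List I) (ys : List J) (f : I → J → Carrier) →
           Σ xs (λ x → Σ ys (f x)) ≈ Σ ys (λ y → Σ xs (λ x → f x y))
  Σ-comm []       ys f = sym (Σ-zero ys)
  Σ-comm (x ∷ xs) ys f = trans (+-congˡ (Σ-comm xs ys f)) (sym (Σ-+ ys (f x) _))

  Σ-map : ∀ (g : I → J) (xs : List I) (f : J → Carrier) → Σ (map g xs) f ≡ Σ xs (f ∘ g)
  Σ-map g []       f = ≡.refl
  Σ-map g (x ∷ xs) f = ≡.cong (λ t → f (g x) + t) (Σ-map g xs f)

  Σ-concatMap : ∀ (g : I → List J) (xs : List I) (f : J → Carrier) →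
                Σ (concatMap g xs) f ≈ Σ xs (λ x → Σ (g x) f)
  Σ-concatMap g []       f = refl
  Σ-concatMap g (x ∷ xs) f = trans (Σ-++ (g x) (concatMap g xs) f) (+-congˡ (Σ-concatMap g xs f))

  Σ-partition : ∀ (p : I → Bool) (xs : List I) (f : I → Carrier) →
                Σ xs f ≈ Σ (filterᵇ (not ∘ p) xs) f + Σ (filterᵇ p xs) f
  Σ-partition p []       f = sym (+-identityˡ 0#)
  Σ-partition p (x ∷ xs) f with p x
  ... | true  = trans (+-congˡ (Σ-partition p xs f)) (x∙yz≈y∙xz _ _ _)
  ... | false = trans (+-congˡ (Σ-partition p xs f)) (sym (+-assoc _ _ _))

  Σ-Σ-+ : ∀ (xs : List I) (ys : List J) (g h : I → J → Carrier) →
          Σ xs (λ j → Σ ys (λ k → g j k + h j k)) ≈ Σ xs (λ j → Σ ys (g j)) + Σ xs (λ j → Σ ys (h j))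
  Σ-Σ-+ xs ys g h = trans (Σ-cong xs (λ j → Σ-+ ys (g j) (h j))) (Σ-+ xs _ _)

  Σ-*-Σ : ∀ (xs : List I) (ys : List J) (f : I → Carrier) (g : J → Carrier) →
          Σ xs f * Σ ys g ≈ Σ xs (λ j → Σ ys (λ k → f j * g k))
  Σ-*-Σ xs ys f g = trans (sym (Σ-*ʳ xs (Σ ys g) f)) (Σ-cong xs (λ j → sym (Σ-*ˡ ys (f j) g)))

  Σ-*-short : ∀ (xs : List I) → length xs < 2 → (f g : I → Carrier) →
              Σ xs f * Σ xs g ≈ Σ xs (λ j → f j * g j)
  Σ-*-short []          _ f g = zeroˡ 0#
  Σ-*-short (x ∷ [])    _ f g = trans (*-cong (+-identityʳ _) (+-identityʳ _)) (sym (+-identityʳ _))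
  Σ-*-short (_ ∷ _ ∷ _) (s≤s (s≤s ()))

  all-filterᵇ : ∀ (p : I → Bool) (xs : List I) → All (T ∘ p) (filterᵇ p xs)
  all-filterᵇ p = all-filter (T? ∘ p)

  infixr 7 [_]·_
  [_]·_ : Bool → Carrier → Carrier
  [ b ]· x = if b then x else 0#

  []·-cong : ∀ b {x y} → x ≈ y → [ b ]· x ≈ [ b ]· y
  []·-cong true  x≈y = x≈y
  []·-cong false x≈y = refl

  []·-+ : ∀ b x y → [ b ]· x + [ b ]· y ≈ [ b ]· (x + y)
  []·-+ true  x y = refl
  []·-+ false x y = +-identityˡ 0#

  []·-*ʳ : ∀ b x y → ([ b ]· x) * y ≈ [ b ]· (x * y)
  []·-*ʳ true  x y = refl
  []·-*ʳ false x y = zeroˡ y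

  []·-∧-T : ∀ b {b′} → T b′ → ∀ x → [ b ∧ b′ ]· x ≈ [ b ]· x
  []·-∧-T true  {true} _ x = refl
  []·-∧-T false        _ x = refl

  Σ-filterᵇ : ∀ (p : I → Bool) (xs : List I) (f : I → Carrier) →
              Σ (filterᵇ p xs) f ≈ Σ xs (λ x → [ p x ]· f x)
  Σ-filterᵇ p []       f = refl
  Σ-filterᵇ p (x ∷ xs) f with p x
  ... | true  = +-congˡ (Σ-filterᵇ p xs f)
  ... | false = trans (Σ-filterᵇ p xs f) (sym (+-identityˡ _))

  Σ-fin-suc : ∀ n (f : Fin (suc n) → Carrier) → Σ-fin (suc n) f ≈ f zero + Σ-fin n (f ∘ suc)
  Σ-fin-suc n f = +-congˡ (reflexive
    (≡.trans (≡.cong (λ xs → Σ xs f) (≡.sym (map-tabulate id suc))) (Σ-map suc (allFin n) f)))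

module Determinant {c ℓ : Level} (F : Field c ℓ) where
  open FieldOps F
  open Field F hiding (zero)
  open Arithmetic F
  open Sums F

  Matrix : ℕ → Set c
  Matrix n = Fin n → Fin n → Carrier

  Σ-fin-punchIn : ∀ n (p : Fin (suc n)) (f : Fin (suc n) → Carrier) →
                  Σ-fin (suc n) f ≈ f p + Σ-fin n (f ∘ punchIn p)
  Σ-fin-punchIn n       zero    f = Σ-fin-suc n f
  Σ-fin-punchIn (suc n) (suc p) f = begin
    Σ-fin (suc (suc n)) f                                       ≈⟨ Σ-fin-suc (suc n) f ⟩
    f zero + Σ-fin (suc n) (f ∘ suc)                             ≈⟨ +-congˡ (Σ-fin-punchIn n p (f ∘ suc)) ⟩
    f zero + (f (suc p) + Σ-fin n (f ∘ suc ∘ punchIn p))          ≈⟨ x∙yz≈y∙xz _ _ _ ⟩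
    f (suc p) + (f zero + Σ-fin n (f ∘ suc ∘ punchIn p))          ≈⟨ +-congˡ (sym (Σ-fin-suc n (f ∘ punchIn (suc p)))) ⟩
    f (suc p) + Σ-fin (suc n) (f ∘ punchIn (suc p))              ∎

  punchIn-fromℕ : ∀ n (i : Fin n) → punchIn (fromℕ n) i ≡ inject₁ i
  punchIn-fromℕ (suc n) zero    = ≡.refl
  punchIn-fromℕ (suc n) (suc i) = ≡.cong suc (punchIn-fromℕ n i)

  Σ-fin-last : ∀ n (f : Fin (suc n) → Carrier) → Σ-fin (suc n) f ≈ Σ-fin n (f ∘ inject₁) + f (fromℕ n)
  Σ-fin-last n f = begin
    Σ-fin (suc n) f                                ≈⟨ Σ-fin-punchIn n (fromℕ n) f ⟩
    f (fromℕ n) + Σ-fin n (f ∘ punchIn (fromℕ n))  ≈⟨ +-comm _ _ ⟩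
    Σ-fin n (f ∘ punchIn (fromℕ n)) + f (fromℕ n)  ≈⟨ +-congʳ (Σ-cong (allFin n) (reflexive ∘ ≡.cong f ∘ punchIn-fromℕ n)) ⟩
    Σ-fin n (f ∘ inject₁) + f (fromℕ n)            ∎

  det-cong : ∀ n {M N : Matrix n} → (∀ a b → M a b ≈ N a b) → det n M ≈ det n N
  det-cong zero    M≈N = refl
  det-cong (suc n) M≈N = Σ-cong (allFin (suc n)) λ j →
    *-congˡ (*-cong (M≈N zero j) (det-cong n (λ a b → M≈N (suc a) (punchIn j b))))

  swap₀₁ : ∀ {n} → Fin (suc (suc n)) → Fin (suc (suc n))
  swap₀₁ zero          = suc zero
  swap₀₁ (suc zero)    = zero
  swap₀₁ (suc (suc a)) = suc (suc a)

  punchIn-punchOut-comm : ∀ {n} (p q : Fin (suc (suc n))) (p≢q : p ≢ q) (q≢p : q ≢ p) (b : Fin n) →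
                          punchIn p (punchIn (punchOut p≢q) b) ≡ punchIn q (punchIn (punchOut q≢p) b)
  punchIn-punchOut-comm zero    zero    p≢q q≢p b = ⊥-elim (p≢q ≡.refl)
  punchIn-punchOut-comm zero    (suc q) p≢q q≢p b = ≡.refl
  punchIn-punchOut-comm (suc p) zero    p≢q q≢p b = ≡.refl
  punchIn-punchOut-comm {suc n} (suc p) (suc q) p≢q q≢p zero    = ≡.refl
  punchIn-punchOut-comm {suc n} (suc p) (suc q) p≢q q≢p (suc b) =
    ≡.cong suc (punchIn-punchOut-comm p q (p≢q ∘ ≡.cong suc) (q≢p ∘ ≡.cong suc) b)

  sgn-punchOut-anticomm : ∀ {n} (p q : Fin (suc (suc n))) (p≢q : p ≢ q) (q≢p : q ≢ p) →
    sgn (toℕ p) * sgn (toℕ (punchOut p≢q)) ≈ - (sgn (toℕ q) * sgn (toℕ (punchOut q≢p)))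
  sgn-punchOut-anticomm zero    zero    p≢q q≢p = ⊥-elim (p≢q ≡.refl)
  sgn-punchOut-anticomm zero    (suc q) p≢q q≢p = solve 2 (λ o s → o :* s := :- ((:- s) :* o)) refl 1# _
  sgn-punchOut-anticomm (suc p) zero    p≢q q≢p = solve 2 (λ o s → (:- s) :* o := :- (o :* s)) refl 1# _
  sgn-punchOut-anticomm {zero}  (suc zero) (suc zero) p≢q q≢p = ⊥-elim (p≢q ≡.refl)
  sgn-punchOut-anticomm {suc n} (suc p) (suc q) p≢q q≢p = begin
    - sp * - so   ≈⟨ solve 2 (λ x y → (:- x) :* (:- y) := x :* y) refl sp so ⟩
    sp * so       ≈⟨ sgn-punchOut-anticomm p q (p≢q ∘ ≡.cong suc) (q≢p ∘ ≡.cong suc) ⟩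
    - (sq * so′)  ≈⟨ -‿cong (solve 2 (λ x y → x :* y := (:- x) :* (:- y)) refl sq so′) ⟩
    - (- sq * - so′) ∎
    where
    sp = sgn (toℕ p)
    sq = sgn (toℕ q)
    so = sgn (toℕ (punchOut (p≢q ∘ ≡.cong suc)))
    so′ = sgn (toℕ (punchOut (q≢p ∘ ≡.cong suc)))

  module TwoRowExpansion {n : ℕ} (N : Matrix (suc (suc n))) where

    minor₂ : Fin (suc (suc n)) → Fin (suc n) → Carrier
    minor₂ p k = det n (λ a b → N (suc (suc a)) (punchIn p (punchIn k b)))

    term : Fin (suc (suc n)) → Fin (suc n) → Carrier
    term p k = sgn (toℕ p) * (N zero p * (sgn (toℕ k) * (N (suc zero) (punchIn p k) * minor₂ p k)))

    term′ : Fin (suc (suc n)) → Fin (suc (suc n)) → Carrier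
    term′ p q with p Fin.≟ q
    ... | yes _   = 0#
    ... | no  p≢q = term p (punchOut p≢q)

    term′-diagonal : ∀ p → term′ p p ≈ 0#
    term′-diagonal p with p Fin.≟ p
    ... | yes _   = refl
    ... | no  p≢p = ⊥-elim (p≢p ≡.refl)

    term′-punchIn : ∀ p k → term′ p (punchIn p k) ≈ term p k
    term′-punchIn p k with p Fin.≟ punchIn p k
    ... | yes p≡ = ⊥-elim (Fin.punchInᵢ≢i p k (≡.sym p≡))
    ... | no  p≢ = reflexive (≡.cong (term p) (≡.trans (Fin.punchOut-cong p ≡.refl) (Fin.punchOut-punchIn p)))

    det-expand₂ : det (suc (suc n)) N ≈ Σ-fin (suc (suc n)) (λ p → Σ-fin (suc (suc n)) (term′ p))
    det-expand₂ = Σ-cong (allFin (suc (suc n))) λ p → begin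
      sgn (toℕ p) * (N zero p * det (suc n) (λ a b → N (suc a) (punchIn p b)))
        ≈⟨ *-congˡ (sym (Σ-*ˡ (allFin (suc n)) (N zero p) _)) ⟩
      sgn (toℕ p) * Σ-fin (suc n) (λ k → N zero p * (sgn (toℕ k) * (N (suc zero) (punchIn p k) * minor₂ p k)))
        ≈⟨ sym (Σ-*ˡ (allFin (suc n)) (sgn (toℕ p)) _) ⟩
      Σ-fin (suc n) (term p)
        ≈⟨ sym (Σ-cong (allFin (suc n)) (term′-punchIn p)) ⟩
      Σ-fin (suc n) (term′ p ∘ punchIn p)
        ≈⟨ sym (+-identityˡ _) ⟩
      0# + Σ-fin (suc n) (term′ p ∘ punchIn p)
        ≈⟨ +-congʳ (sym (term′-diagonal p)) ⟩
      term′ p p + Σ-fin (suc n) (term′ p ∘ punchIn p)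
        ≈⟨ sym (Σ-fin-punchIn (suc n) p (term′ p)) ⟩
      Σ-fin (suc (suc n)) (term′ p) ∎

  open TwoRowExpansion using (term′; det-expand₂)

  term′-swap₀₁ : ∀ {n} (N : Matrix (suc (suc n))) p q → term′ N p q ≈ - term′ (N ∘ swap₀₁) q p
  term′-swap₀₁ {n} N p q with p Fin.≟ q | q Fin.≟ p
  ... | yes _   | yes _   = sym -0#≈0#
  ... | yes p≡q | no  q≢p = ⊥-elim (q≢p (≡.sym p≡q))
  ... | no  p≢q | yes q≡p = ⊥-elim (p≢q (≡.sym q≡p))
  ... | no  p≢q | no  q≢p = begin
      sp * (N zero p * (sk * (N (suc zero) (punchIn p k) * minor₂ N p k)))
        ≈⟨ *-congˡ (*-congˡ (*-congˡ (*-cong (reflexive (≡.cong (N (suc zero)) (Fin.punchIn-punchOut p≢q)))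
             (det-cong n (λ a b → reflexive (≡.cong (N (suc (suc a))) (punchIn-punchOut-comm p q p≢q q≢p b))))))) ⟩
      sp * (N zero p * (sk * (N (suc zero) q * D)))
        ≈⟨ solve 5 (λ a b x y d → a :* (x :* (b :* (y :* d))) := (a :* b) :* (x :* (y :* d))) refl sp sk (N zero p) (N (suc zero) q) D ⟩
      (sp * sk) * (N zero p * (N (suc zero) q * D))
        ≈⟨ *-congʳ (sgn-punchOut-anticomm p q p≢q q≢p) ⟩
      - (sq * sk′) * (N zero p * (N (suc zero) q * D))
        ≈⟨ solve 5 (λ a b x y d → (:- (a :* b)) :* (x :* (y :* d)) := :- (a :* (y :* (b :* (x :* d))))) refl sq sk′ (N zero p) (N (suc zero) q) D ⟩
      - (sq * (N (suc zero) q * (sk′ * (N zero p * D))))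
        ≈⟨ -‿cong (*-congˡ (*-congˡ (*-congˡ (*-congʳ (reflexive (≡.cong (N zero) (≡.sym (Fin.punchIn-punchOut q≢p)))))))) ⟩
      - (sq * (N (suc zero) q * (sk′ * (N zero (punchIn q k′) * D)))) ∎
    where
    open TwoRowExpansion using (minor₂)
    k = punchOut p≢q
    k′ = punchOut q≢p
    sp = sgn (toℕ p)
    sk = sgn (toℕ k)
    sq = sgn (toℕ q)
    sk′ = sgn (toℕ k′)
    D = det n (λ a b → N (suc (suc a)) (punchIn q (punchIn k′ b)))

  det-swap₀₁ : ∀ n (N : Matrix (suc (suc n))) → det (suc (suc n)) N ≈ - det (suc (suc n)) (N ∘ swap₀₁)
  det-swap₀₁ n N = begin
    det (suc (suc n)) N                            ≈⟨ det-expand₂ N ⟩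
    Σ-fin _ (λ p → Σ-fin _ (term′ N p))            ≈⟨ Σ-cong U (λ p → Σ-cong U (term′-swap₀₁ N p)) ⟩
    Σ-fin _ (λ p → Σ-fin _ (λ q → - term′ N′ q p)) ≈⟨ Σ-cong U (λ p → Σ-neg U (λ q → term′ N′ q p)) ⟩
    Σ-fin _ (λ p → - Σ-fin _ (λ q → term′ N′ q p)) ≈⟨ Σ-neg U _ ⟩
    - Σ-fin _ (λ p → Σ-fin _ (λ q → term′ N′ q p)) ≈⟨ -‿cong (Σ-comm U U (λ p q → term′ N′ q p)) ⟩
    - Σ-fin _ (λ q → Σ-fin _ (term′ N′ q))         ≈⟨ -‿cong (sym (det-expand₂ N′)) ⟩
    - det (suc (suc n)) N′                         ∎
    where
    U = allFin (suc (suc n))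
    N′ = N ∘ swap₀₁

module Elimination {c ℓ : Level} (F : Field c ℓ) (2≉0 : ¬ Field._≈_ F (FieldOps.fromℕ' F 2) (Field.0# F)) where
  open FieldOps F
  open Field F hiding (zero)
  open Arithmetic F
  open Sums F
  open Determinant F

  x≈-x⇒x≈0 : ∀ x → x ≈ - x → x ≈ 0#
  x≈-x⇒x≈0 x x≈-x = begin
    x                  ≈⟨ sym (*-identityˡ x) ⟩
    1# * x             ≈⟨ *-congʳ (sym (trans (*-comm _ _) (⁻¹-inverseʳ 2# 2≉0))) ⟩
    (2# ⁻¹ * 2#) * x   ≈⟨ *-assoc _ _ _ ⟩
    2# ⁻¹ * (2# * x)   ≈⟨ *-congˡ (solve 1 (λ y → con (+ 2) :* y := y :+ y) refl x) ⟩
    2# ⁻¹ * (x + x)    ≈⟨ *-congˡ (trans (+-congˡ x≈-x) (-‿inverseʳ x)) ⟩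
    2# ⁻¹ * 0#         ≈⟨ zeroʳ _ ⟩
    0#                 ∎
    where 2# = fromℕ' 2

  det-row₀≈row : ∀ n (N : Matrix (suc (suc n))) (b : Fin (suc n)) →
                 (∀ x → N zero x ≈ N (suc b) x) → det (suc (suc n)) N ≈ 0#
  det-row₀≈row n N zero row₀≈row₁ = x≈-x⇒x≈0 _ (trans (det-swap₀₁ n N) (-‿cong (det-cong (suc (suc n)) {N ∘ swap₀₁} {N} λ
    { zero x → sym (row₀≈row₁ x) ; (suc zero) x → row₀≈row₁ x ; (suc (suc a)) x → refl })))
  det-row₀≈row (suc n) N (suc b) row₀≈row = begin
    det (suc (suc (suc n))) N             ≈⟨ det-swap₀₁ (suc n) N ⟩
    - det (suc (suc (suc n))) (N ∘ swap₀₁) ≈⟨ -‿cong (trans (Σ-cong U term≈0) (Σ-zero U)) ⟩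
    - 0#                                  ≈⟨ -0#≈0# ⟩
    0#                                    ∎
    where
    U = allFin (suc (suc (suc n)))
    -- each first-row minor of N ∘ swap₀₁ still contains the equal rows 0 and suc b of N
    term≈0 : ∀ j → sgn (toℕ j) * (N (suc zero) j * det (suc (suc n)) (λ a x → N (swap₀₁ (suc a)) (punchIn j x))) ≈ 0#
    term≈0 j = begin
      sgn (toℕ j) * (N (suc zero) j * det (suc (suc n)) (λ a x → N (swap₀₁ (suc a)) (punchIn j x)))
        ≈⟨ *-congˡ (*-congˡ (det-row₀≈row n (λ a x → N (swap₀₁ (suc a)) (punchIn j x)) b (row₀≈row ∘ punchIn j))) ⟩
      sgn (toℕ j) * (N (suc zero) j * 0#) ≈⟨ trans (*-congˡ (zeroʳ _)) (zeroʳ _) ⟩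
      0# ∎

  addLastRow : ∀ {k} n → (Fin n → Carrier) → (Fin (suc n) → Fin k → Carrier) → Fin (suc n) → Fin k → Carrier
  addLastRow zero    c R a       b = R a b
  addLastRow (suc n) c R zero    b = R zero b + c zero * R (fromℕ (suc n)) b
  addLastRow (suc n) c R (suc a) b = addLastRow n (c ∘ suc) (R ∘ suc) a b

  addLastRow-∘-columns : ∀ {k k′} n c (R : Fin (suc n) → Fin k → Carrier) (f : Fin k′ → Fin k) a b →
                         addLastRow n c R a (f b) ≡ addLastRow n c (λ a′ → R a′ ∘ f) a b
  addLastRow-∘-columns zero    c R f a       b = ≡.refl
  addLastRow-∘-columns (suc n) c R f zero    b = ≡.refl
  addLastRow-∘-columns (suc n) c R f (suc a) b = addLastRow-∘-columns n (c ∘ suc) (R ∘ suc) f a b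

  addLastRow-inject₁ : ∀ {k} n c (R : Fin (suc n) → Fin k → Carrier) i b →
                       addLastRow n c R (inject₁ i) b ≡ R (inject₁ i) b + c i * R (fromℕ n) b
  addLastRow-inject₁ (suc n) c R zero    b = ≡.refl
  addLastRow-inject₁ (suc n) c R (suc i) b = addLastRow-inject₁ n (c ∘ suc) (R ∘ suc) i b

  addLastRow-fromℕ : ∀ {k} n c (R : Fin (suc n) → Fin k → Carrier) b → addLastRow n c R (fromℕ n) b ≡ R (fromℕ n) b
  addLastRow-fromℕ zero    c R b = ≡.refl
  addLastRow-fromℕ (suc n) c R b = addLastRow-fromℕ n (c ∘ suc) (R ∘ suc) b

  det-addLastRow : ∀ n c (M : Matrix (suc n)) → det (suc n) (addLastRow n c M) ≈ det (suc n) M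
  det-addLastRow zero    c M = refl
  det-addLastRow (suc n) c M = begin
    det (suc (suc n)) (addLastRow (suc n) c M)
      ≈⟨ Σ-cong U (λ j → *-congˡ (*-congˡ (trans
           (det-cong (suc n) (λ a b → reflexive (addLastRow-∘-columns n (c ∘ suc) (M ∘ suc) (punchIn j) a b)))
           (det-addLastRow n (c ∘ suc) (λ a b → M (suc a) (punchIn j b)))))) ⟩
    Σ-fin (suc (suc n)) (λ j → sgn (toℕ j) * ((M zero j + c zero * M last j) * minor j))
      ≈⟨ Σ-cong U (λ j → solve 5 (λ s x k y d → s :* ((x :+ k :* y) :* d) := s :* (x :* d) :+ k :* (s :* (y :* d)))
                             refl (sgn (toℕ j)) (M zero j) (c zero) (M last j) (minor j)) ⟩
    Σ-fin (suc (suc n)) (λ j → sgn (toℕ j) * (M zero j * minor j) + c zero * (sgn (toℕ j) * (M last j * minor j)))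
      ≈⟨ trans (Σ-+ U _ _) (+-congˡ (Σ-*ˡ U (c zero) _)) ⟩
    det (suc (suc n)) M + c zero * det (suc (suc n)) lastRowFirst
      ≈⟨ +-congˡ (*-congˡ (det-row₀≈row n lastRowFirst (fromℕ n) (λ _ → refl))) ⟩
    det (suc (suc n)) M + c zero * 0#
      ≈⟨ trans (+-congˡ (zeroʳ _)) (+-identityʳ _) ⟩
    det (suc (suc n)) M ∎
    where
    U = allFin (suc (suc n))
    last = fromℕ (suc n)
    minor = λ j → det (suc n) (λ a b → M (suc a) (punchIn j b))
    lastRowFirst : Matrix (suc (suc n))
    lastRowFirst zero    = M last
    lastRowFirst (suc a) = M (suc a)

  punchIn-inject₁-fromℕ : ∀ m (j : Fin (suc m)) → punchIn (inject₁ j) (fromℕ m) ≡ fromℕ (suc m)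
  punchIn-inject₁-fromℕ m       zero    = ≡.refl
  punchIn-inject₁-fromℕ (suc m) (suc j) = ≡.cong suc (punchIn-inject₁-fromℕ m j)

  punchIn-inject₁-inject₁ : ∀ m (j : Fin (suc m)) (l : Fin m) → punchIn (inject₁ j) (inject₁ l) ≡ inject₁ (punchIn j l)
  punchIn-inject₁-inject₁ m       zero    l       = ≡.refl
  punchIn-inject₁-inject₁ (suc m) (suc j) zero    = ≡.refl
  punchIn-inject₁-inject₁ (suc m) (suc j) (suc l) = ≡.cong suc (punchIn-inject₁-inject₁ m j l)

  det-lastColumn≈0 : ∀ m (M : Matrix (suc m)) → (∀ i → M (inject₁ i) (fromℕ m) ≈ 0#) →
                     det (suc m) M ≈ M (fromℕ m) (fromℕ m) * det m (λ i l → M (inject₁ i) (inject₁ l))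
  det-lastColumn≈0 zero    M col≈0 = trans (+-identityʳ _) (*-identityˡ _)
  det-lastColumn≈0 (suc m) M col≈0 = begin
    det (suc (suc m)) M                                   ≈⟨ Σ-fin-last (suc m) term ⟩
    Σ-fin (suc m) (term ∘ inject₁) + term last            ≈⟨ +-cong (Σ-cong (allFin (suc m)) term-inject₁) term-last ⟩
    Σ-fin (suc m) (λ j → corner * topTerm j) + 0#        ≈⟨ +-identityʳ _ ⟩
    Σ-fin (suc m) (λ j → corner * topTerm j)             ≈⟨ Σ-*ˡ (allFin (suc m)) corner topTerm ⟩
    corner * det (suc m) top                              ∎
    where
    last = fromℕ (suc m)
    corner = M last last
    top = λ i l → M (inject₁ i) (inject₁ l)
    term = λ j → sgn (toℕ j) * (M zero j * det (suc m) (λ a b → M (suc a) (punchIn j b)))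
    topTerm = λ j → sgn (toℕ j) * (top zero j * det m (λ a b → top (suc a) (punchIn j b)))
    term-last : term last ≈ 0#
    term-last = trans (*-congˡ (trans (*-congʳ (col≈0 zero)) (zeroˡ _))) (zeroʳ _)
    term-inject₁ : ∀ j → term (inject₁ j) ≈ corner * topTerm j
    term-inject₁ j = begin
      term (inject₁ j)
        ≈⟨ *-cong (reflexive (≡.cong sgn (Fin.toℕ-inject₁ j)))
             (*-congˡ (det-lastColumn≈0 m (λ a b → M (suc a) (punchIn (inject₁ j) b))
               (λ i → trans (reflexive (≡.cong (M (suc (inject₁ i))) (punchIn-inject₁-fromℕ m j))) (col≈0 (suc i))))) ⟩
      sgn (toℕ j) * (M zero (inject₁ j) * (M last (punchIn (inject₁ j) (fromℕ m)) *
          det m (λ a b → M (suc (inject₁ a)) (punchIn (inject₁ j) (inject₁ b)))))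
        ≈⟨ *-congˡ (*-congˡ (*-cong (reflexive (≡.cong (M last) (punchIn-inject₁-fromℕ m j)))
             (det-cong m (λ a b → reflexive (≡.cong (M (suc (inject₁ a))) (punchIn-inject₁-inject₁ m j b)))))) ⟩
      sgn (toℕ j) * (top zero j * (corner * det m (λ a b → top (suc a) (punchIn j b))))
        ≈⟨ solve 4 (λ s x y d → s :* (x :* (y :* d)) := y :* (s :* (x :* d))) refl _ _ _ _ ⟩
      corner * topTerm j ∎

  det-eliminateLastColumn : ∀ m (M : Matrix (suc m)) (c : Fin m → Carrier) →
    (∀ i → M (inject₁ i) (fromℕ m) + c i * M (fromℕ m) (fromℕ m) ≈ 0#) →
    det (suc m) M ≈ M (fromℕ m) (fromℕ m) * det m (λ i l → M (inject₁ i) (inject₁ l) + c i * M (fromℕ m) (inject₁ l))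
  det-eliminateLastColumn m M c cleared = begin
    det (suc m) M
      ≈⟨ sym (det-addLastRow m c M) ⟩
    det (suc m) M′
      ≈⟨ det-lastColumn≈0 m M′ (λ i → trans (reflexive (addLastRow-inject₁ m c M i (fromℕ m))) (cleared i)) ⟩
    M′ (fromℕ m) (fromℕ m) * det m (λ i l → M′ (inject₁ i) (inject₁ l))
      ≈⟨ *-cong (reflexive (addLastRow-fromℕ m c M (fromℕ m)))
                (det-cong m (λ i l → reflexive (addLastRow-inject₁ m c M i (inject₁ l)))) ⟩
    M (fromℕ m) (fromℕ m) * det m (λ i l → M (inject₁ i) (inject₁ l) + c i * M (fromℕ m) (inject₁ l)) ∎
    where M′ = addLastRow m c M

module PairSums {c ℓ : Level} (F : Field c ℓ) {n : ℕ} where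
  open FieldOps F renaming (Σ-list to Σ)
  open Field F hiding (zero)
  open Arithmetic F
  open Sums F

  _<ᵇ_ : Fin n → Fin n → Bool
  j <ᵇ k = ⌊ j Fin.<? k ⌋

  <ᵇ-irrefl : ∀ j → (j <ᵇ j) ≡ false
  <ᵇ-irrefl j with j Fin.<? j
  ... | yes j<j = ⊥-elim (Fin.<-irrefl ≡.refl j<j)
  ... | no  _   = ≡.refl

  Σ-pairs : List (Fin n) → (Fin n → Fin n → Carrier) → Carrier
  Σ-pairs xs h = Σ xs (λ j → Σ xs (λ k → [ j <ᵇ k ]· h j k))

  Σ-pairs-cong-All : ∀ {xs} {g h : Fin n → Fin n → Carrier} →
                     All (λ j → All (λ k → g j k ≈ h j k) xs) xs → Σ-pairs xs g ≈ Σ-pairs xs h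
  Σ-pairs-cong-All g≈h = Σ-cong-All (All.map (λ {j} → Σ-cong-All ∘ All.map (λ {k} → []·-cong (j <ᵇ k))) g≈h)

  Σ-pairs-cong : ∀ (xs : List (Fin n)) {g h : Fin n → Fin n → Carrier} →
                 (∀ j k → g j k ≈ h j k) → Σ-pairs xs g ≈ Σ-pairs xs h
  Σ-pairs-cong xs g≈h = Σ-cong xs (λ j → Σ-cong xs (λ k → []·-cong (j <ᵇ k) (g≈h j k)))

  Σ-pairs-*ʳ : ∀ (xs : List (Fin n)) (h : Fin n → Fin n → Carrier) w →
               Σ-pairs xs h * w ≈ Σ-pairs xs (λ j k → h j k * w)
  Σ-pairs-*ʳ xs h w = begin
    Σ-pairs xs h * w                                       ≈⟨ sym (Σ-*ʳ xs w _) ⟩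
    Σ xs (λ j → Σ xs (λ k → [ j <ᵇ k ]· h j k) * w)        ≈⟨ Σ-cong xs (λ j → sym (Σ-*ʳ xs w _)) ⟩
    Σ xs (λ j → Σ xs (λ k → ([ j <ᵇ k ]· h j k) * w))      ≈⟨ Σ-cong xs (λ j → Σ-cong xs (λ k → []·-*ʳ (j <ᵇ k) _ w)) ⟩
    Σ-pairs xs (λ j k → h j k * w)                         ∎

  split-by-order : ∀ j k x → (j ≡ k → x ≈ 0#) → x ≈ [ j <ᵇ k ]· x + [ k <ᵇ j ]· x
  split-by-order j k x diag with j Fin.<? k | k Fin.<? j | Fin.<-cmp j k
  ... | yes j<k | yes k<j | _             = ⊥-elim (Fin.<-asym j<k k<j)
  ... | yes _   | no  _   | _             = sym (+-identityʳ x)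
  ... | no  _   | yes _   | _             = sym (+-identityˡ x)
  ... | no  j≮k | no  _   | tri< j<k _ _  = ⊥-elim (j≮k j<k)
  ... | no  _   | no  k≮j | tri> _ _ k<j  = ⊥-elim (k≮j k<j)
  ... | no  _   | no  _   | tri≈ _ j≡k _  = trans (diag j≡k) (sym (+-identityˡ 0#))

  Σ-symmetrise : ∀ (xs : List (Fin n)) (f : Fin n → Fin n → Carrier) → All (λ j → f j j ≈ 0#) xs →
                 Σ xs (λ j → Σ xs (f j)) ≈ Σ-pairs xs (λ j k → f j k + f k j)
  Σ-symmetrise xs f diag = begin
    Σ xs (λ j → Σ xs (f j))
      ≈⟨ Σ-cong-All (All.map (λ {j} fjj≈0 → Σ-cong xs (λ k → split-by-order j k (f j k) (λ { ≡.refl → fjj≈0 }))) diag) ⟩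
    Σ xs (λ j → Σ xs (λ k → [ j <ᵇ k ]· f j k + [ k <ᵇ j ]· f j k))
      ≈⟨ Σ-Σ-+ xs xs _ _ ⟩
    Σ-pairs xs f + Σ xs (λ j → Σ xs (λ k → [ k <ᵇ j ]· f j k))
      ≈⟨ +-congˡ (Σ-comm xs xs (λ j k → [ k <ᵇ j ]· f j k)) ⟩
    Σ-pairs xs f + Σ-pairs xs (λ j k → f k j)
      ≈⟨ sym (Σ-Σ-+ xs xs _ _) ⟩
    Σ xs (λ j → Σ xs (λ k → [ j <ᵇ k ]· f j k + [ j <ᵇ k ]· f k j))
      ≈⟨ Σ-cong xs (λ j → Σ-cong xs (λ k → []·-+ (j <ᵇ k) _ _)) ⟩
    Σ-pairs xs (λ j k → f j k + f k j) ∎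

  Σ-pairs-short : ∀ (xs : List (Fin n)) → length xs < 2 → (h : Fin n → Fin n → Carrier) → Σ-pairs xs h ≈ 0#
  Σ-pairs-short []          _ h = refl
  Σ-pairs-short (x ∷ [])    _ h rewrite <ᵇ-irrefl x = trans (+-identityʳ _) (+-identityʳ _)
  Σ-pairs-short (_ ∷ _ ∷ _) (s≤s (s≤s ()))

  -- Cauchy–Binet for the 2 × 2 Gram determinant of the columns (α, b) and (α, c)
  -- weighted by z; the hypothesis α² = 1 makes Σ α z α equal to Σ z.
  cauchy-binet₂ : ∀ (xs : List (Fin n)) (α b c z : Fin n → Carrier) → All (λ j → α j * α j ≈ 1#) xs →
    Σ xs (λ j → b j * (z j * c j)) * Σ xs z - Σ xs (λ j → b j * (z j * α j)) * Σ xs (λ k → α k * (z k * c k))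
    ≈ Σ-pairs xs (λ j k → (b j - α j * α k * b k) * ((z j * z k) * (c j - α j * α k * c k)))
  cauchy-binet₂ xs α b c z α²≈1 = begin
    Σ xs bzc * Σ xs z - Σ xs bzα * Σ xs αzc
      ≈⟨ +-cong (Σ-*-Σ xs xs bzc z) (-‿cong (Σ-*-Σ xs xs bzα αzc)) ⟩
    Σ xs (λ j → Σ xs (λ k → bzc j * z k)) - Σ xs (λ j → Σ xs (λ k → bzα j * αzc k))
      ≈⟨ +-congˡ (sym (trans (Σ-cong xs (λ j → Σ-neg xs _)) (Σ-neg xs _))) ⟩
    Σ xs (λ j → Σ xs (λ k → bzc j * z k)) + Σ xs (λ j → Σ xs (λ k → - (bzα j * αzc k)))
      ≈⟨ sym (Σ-Σ-+ xs xs _ _) ⟩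
    Σ xs (λ j → Σ xs (f j))
      ≈⟨ Σ-symmetrise xs f (All.map f-diagonal α²≈1) ⟩
    Σ-pairs xs (λ j k → f j k + f k j)
      ≈⟨ Σ-pairs-cong-All (All.map (λ αj²≈1 → All.map (f-symmetrised αj²≈1) α²≈1) α²≈1) ⟩
    Σ-pairs xs g ∎
    where
    bzc = λ j → b j * (z j * c j)
    bzα = λ j → b j * (z j * α j)
    αzc = λ k → α k * (z k * c k)
    f g : Fin n → Fin n → Carrier
    f j k = bzc j * z k - bzα j * αzc k
    g j k = (b j - α j * α k * b k) * ((z j * z k) * (c j - α j * α k * c k))

    f-diagonal : ∀ {j} → α j * α j ≈ 1# → f j j ≈ 0#
    f-diagonal {j} αj²≈1 = begin
      f j j                               ≈⟨ solve 4 (λ bj cj aj zj → (bj :* (zj :* cj)) :* zj :- (bj :* (zj :* aj)) :* (aj :* (zj :* cj))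
                                                        := ((bj :* (zj :* cj)) :* zj) :* (con (+ 1) :- aj :* aj)) refl (b j) (c j) (α j) (z j) ⟩
      (bzc j * z j) * (ι (+ 1) - α j * α j) ≈⟨ *-congˡ (1-x≈0 αj²≈1) ⟩
      (bzc j * z j) * 0#                  ≈⟨ zeroʳ _ ⟩
      0#                                  ∎

    f-symmetrised : ∀ {j k} → α j * α j ≈ 1# → α k * α k ≈ 1# → f j k + f k j ≈ g j k
    f-symmetrised {j} {k} αj²≈1 αk²≈1 = begin
      f j k + f k j
        ≈⟨ solve 8 (λ bj bk cj ck aj ak zj zk →
             ((bj :* (zj :* cj)) :* zk :- (bj :* (zj :* aj)) :* (ak :* (zk :* ck)))
               :+ ((bk :* (zk :* ck)) :* zj :- (bk :* (zk :* ak)) :* (aj :* (zj :* cj)))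
             := (bj :- aj :* ak :* bk) :* ((zj :* zk) :* (cj :- aj :* ak :* ck))
               :+ ((zj :* zk) :* (bk :* ck)) :* (con (+ 1) :- (aj :* aj) :* (ak :* ak)))
             refl (b j) (b k) (c j) (c k) (α j) (α k) (z j) (z k) ⟩
      g j k + ((z j * z k) * (b k * c k)) * (ι (+ 1) - (α j * α j) * (α k * α k))
        ≈⟨ +-congˡ (*-congˡ (1-x≈0 (trans (*-cong αj²≈1 αk²≈1) (*-identityˡ 1#)))) ⟩
      g j k + ((z j * z k) * (b k * c k)) * 0#
        ≈⟨ trans (+-congˡ (zeroʳ _)) (+-identityʳ _) ⟩
      g j k ∎

module StarMeshProof {c ℓ : Level} (F : Field c ℓ) (2≉0 : ¬ Field._≈_ F (FieldOps.fromℕ' F 2) (Field.0# F))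
                     (m n : ℕ) (A : Fin (suc m) → Fin n → ℤ) (A-sign : ∀ i j → IsSignEntry (A i j))
                     (z : Fin n → Field.Carrier F) where
  open FieldOps F renaming (Σ-list to Σ)
  open Field F hiding (zero)
  open Arithmetic F
  open Sums F
  open Determinant F using (det-cong)
  open Elimination F 2≉0 using (det-eliminateLastColumn)
  open PairSums F
  open StarMesh m n A z

  r : Fin (suc m)
  r = fromℕ m

  α : Fin n → Carrier
  α j = ι (rowR j)

  a : Fin m → Fin n → Carrier
  a i j = ι (A (inject₁ i) j)

  M : Fin (suc m) → Fin (suc m) → Carrier
  M = AXAᵀ (suc m) (allFin n) Aℤ z

  α≈0 : ∀ {j} → T (not (inN1 j)) → α j ≈ 0#
  α≈0 {j} j∉N1 with rowR j | A-sign r j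
  ... | _ | inj₁ ≡.refl        = refl
  ... | _ | inj₂ (inj₁ ≡.refl) = ⊥-elim j∉N1
  ... | _ | inj₂ (inj₂ ≡.refl) = ⊥-elim j∉N1

  α²≈1 : ∀ {j} → T (inN1 j) → α j * α j ≈ 1#
  α²≈1 {j} j∈N1 with rowR j | A-sign r j
  ... | _ | inj₁ ≡.refl        = ⊥-elim j∈N1
  ... | _ | inj₂ (inj₁ ≡.refl) = trans (solve 0 (con (+ 1) :* con (+ 1) := con (+ 1)) refl) (+-identityʳ 1#)
  ... | _ | inj₂ (inj₂ ≡.refl) = trans (solve 0 (con -[1+ 0 ] :* con -[1+ 0 ] := con (+ 1)) refl) (+-identityʳ 1#)

  on-N1 : ∀ {p} {P : Fin n → Set p} → (∀ {j} → T (inN1 j) → P j) → All P N1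
  on-N1 P-on-N1 = All.map P-on-N1 (all-filterᵇ inN1 (allFin n))

  on-N0 : ∀ {p} {P : Fin n → Set p} → (∀ {j} → T (not (inN1 j)) → P j) → All P N0
  on-N0 P-on-N0 = All.map P-on-N0 (all-filterᵇ (not ∘ inN1) (allFin n))

  Σ-restrict-N1 : ∀ (f : Fin n → Carrier) → (∀ {j} → T (not (inN1 j)) → f j ≈ 0#) → Σ-fin n f ≈ Σ N1 f
  Σ-restrict-N1 f f≈0 = begin
    Σ-fin n f               ≈⟨ Σ-partition inN1 (allFin n) f ⟩
    Σ N0 f + Σ N1 f         ≈⟨ +-congʳ (trans (Σ-cong-All (on-N0 f≈0)) (Σ-zero N0)) ⟩
    0# + Σ N1 f             ≈⟨ +-identityˡ _ ⟩
    Σ N1 f                  ∎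

  M-lastColumn : ∀ i → M (inject₁ i) r ≈ Σ N1 (λ j → a i j * (z j * α j))
  M-lastColumn i = Σ-restrict-N1 _ (λ j∉N1 → trans (*-congˡ (trans (*-congˡ (α≈0 j∉N1)) (zeroʳ _))) (zeroʳ _))

  M-lastRow : ∀ l → M r (inject₁ l) ≈ Σ N1 (λ j → α j * (z j * a l j))
  M-lastRow l = Σ-restrict-N1 _ (λ j∉N1 → trans (*-congʳ (α≈0 j∉N1)) (zeroˡ _))

  M-corner : M r r ≈ y
  M-corner = trans (Σ-restrict-N1 _ (λ j∉N1 → trans (*-congʳ (α≈0 j∉N1)) (zeroˡ _)))
    (Σ-cong-All (on-N1 λ {j} j∈N1 → begin
      α j * (z j * α j)  ≈⟨ solve 2 (λ x w → x :* (w :* x) := (x :* x) :* w) refl (α j) (z j) ⟩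
      (α j * α j) * z j  ≈⟨ *-congʳ (α²≈1 j∈N1) ⟩
      1# * z j           ≈⟨ *-identityˡ _ ⟩
      z j                ∎))

  pairTerm : Fin m → Fin m → Fin n × Fin n → Carrier
  pairTerm i l p = A' i (inj₂ p) * (X' (inj₂ p) * A' l (inj₂ p))

  A'-pair : ∀ i j k → A' i (inj₂ (j , k)) ≈ a i j - α j * α k * a i k
  A'-pair i j k = begin
    ι (x ℤ.- q)                 ≈⟨ ι-+ x (ℤ.- q) ⟩
    a i j + ι (ℤ.- q)           ≈⟨ +-congˡ (ι-neg q) ⟩
    a i j - ι q                 ≈⟨ +-congˡ (-‿cong (ι-* (rowR j ℤ.* rowR k) (A (inject₁ i) k))) ⟩
    a i j - ι (rowR j ℤ.* rowR k) * a i k ≈⟨ +-congˡ (-‿cong (*-congʳ (ι-* (rowR j) (rowR k)))) ⟩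
    a i j - α j * α k * a i k   ∎
    where
    x = A (inject₁ i) j
    q = rowR j ℤ.* rowR k ℤ.* A (inject₁ i) k

  Σ-N1choose2 : ∀ (h : Fin n × Fin n → Carrier) → Σ N1choose2 h ≈ Σ-pairs N1 (λ j k → h (j , k))
  Σ-N1choose2 h = begin
    Σ N1choose2 h
      ≈⟨ Σ-concatMap _ N1 h ⟩
    Σ N1 (λ j → Σ (map (j ,_) (filterᵇ (λ k → j <ᵇ k ∧ inN1 k) N1)) h)
      ≈⟨ Σ-cong N1 (λ j → reflexive (Σ-map (j ,_) (filterᵇ (λ k → j <ᵇ k ∧ inN1 k) N1) h)) ⟩
    Σ N1 (λ j → Σ (filterᵇ (λ k → j <ᵇ k ∧ inN1 k) N1) (λ k → h (j , k)))
      ≈⟨ Σ-cong N1 (λ j → Σ-filterᵇ _ N1 _) ⟩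
    Σ N1 (λ j → Σ N1 (λ k → [ j <ᵇ k ∧ inN1 k ]· h (j , k)))
      ≈⟨ Σ-cong N1 (λ j → Σ-cong-All (on-N1 (λ {k} k∈N1 → []·-∧-T (j <ᵇ k) k∈N1 _))) ⟩
    Σ-pairs N1 (λ j k → h (j , k)) ∎

  S-entry : ∀ i l → AXAᵀ m cols' A' X' i l ≈ Σ N0 (λ j → a i j * (z j * a l j)) + Σ N1choose2 (pairTerm i l)
  S-entry i l = trans (Σ-++ (map inj₁ N0) (map inj₂ N1choose2) term)
    (+-cong (reflexive (Σ-map inj₁ N0 term)) (reflexive (Σ-map inj₂ N1choose2 term)))
    where term = λ col → A' i col * (X' col * A' l col)

  lhs≈rhs-by-multiplier : (μ : Fin m → Carrier) →
    (∀ i → M (inject₁ i) r + μ i * y ≈ 0#) →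
    (∀ i l → Σ N1 (λ j → a i j * (z j * a l j)) + μ i * M r (inject₁ l) ≈ Σ N1choose2 (pairTerm i l)) →
    lhs ≈ rhs
  lhs≈rhs-by-multiplier μ cleared reduced = trans
    (det-eliminateLastColumn m M μ (λ i → trans (+-congˡ (*-congˡ M-corner)) (cleared i)))
    (*-cong M-corner (det-cong m entry))
    where
    entry : ∀ i l → M (inject₁ i) (inject₁ l) + μ i * M r (inject₁ l) ≈ AXAᵀ m cols' A' X' i l
    entry i l = begin
      M (inject₁ i) (inject₁ l) + μ i * M r (inject₁ l)
        ≈⟨ +-congʳ (Σ-partition inN1 (allFin n) _) ⟩
      (Σ N0 (λ j → a i j * (z j * a l j)) + Σ N1 (λ j → a i j * (z j * a l j))) + μ i * M r (inject₁ l)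
        ≈⟨ +-assoc _ _ _ ⟩
      Σ N0 (λ j → a i j * (z j * a l j)) + (Σ N1 (λ j → a i j * (z j * a l j)) + μ i * M r (inject₁ l))
        ≈⟨ +-congˡ (reduced i l) ⟩
      Σ N0 (λ j → a i j * (z j * a l j)) + Σ N1choose2 (pairTerm i l)
        ≈⟨ sym (S-entry i l) ⟩
      AXAᵀ m cols' A' X' i l ∎

  lhs≈rhs-if-y≉0 : ¬ y ≈ 0# → lhs ≈ rhs
  lhs≈rhs-if-y≉0 y≉0 = lhs≈rhs-by-multiplier μ cleared reduced
    where
    w = y ⁻¹

    yw≈1 : y * w ≈ 1#
    yw≈1 = ⁻¹-inverseʳ y y≉0

    μ : Fin m → Carrier
    μ i = - (M (inject₁ i) r * w)

    cleared : ∀ i → M (inject₁ i) r + μ i * y ≈ 0#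
    cleared i = begin
      x + - (x * w) * y    ≈⟨ solve 3 (λ x w y → x :+ (:- (x :* w)) :* y := x :- x :* (y :* w)) refl x w y ⟩
      x - x * (y * w)      ≈⟨ +-congˡ (-‿cong (trans (*-congˡ yw≈1) (*-identityʳ x))) ⟩
      x - x                ≈⟨ -‿inverseʳ x ⟩
      0#                   ∎
      where x = M (inject₁ i) r

    reduced : ∀ i l → Σ N1 (λ j → a i j * (z j * a l j)) + μ i * M r (inject₁ l) ≈ Σ N1choose2 (pairTerm i l)
    reduced i l = begin
      s₁ + - (M (inject₁ i) r * w) * M r (inject₁ l)
        ≈⟨ +-cong (sym (trans (*-congˡ yw≈1) (*-identityʳ s₁))) (*-cong (-‿cong (*-congʳ (M-lastColumn i))) (M-lastRow l)) ⟩
      s₁ * (y * w) + - (s₂ * w) * s₃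
        ≈⟨ solve 5 (λ x y w u v → x :* (y :* w) :+ (:- (u :* w)) :* v := (x :* y :- u :* v) :* w) refl s₁ y w s₂ s₃ ⟩
      (s₁ * y - s₂ * s₃) * w
        ≈⟨ *-congʳ (cauchy-binet₂ N1 α (a i) (a l) z (on-N1 α²≈1)) ⟩
      Σ-pairs N1 g * w
        ≈⟨ Σ-pairs-*ʳ N1 g w ⟩
      Σ-pairs N1 (λ j k → g j k * w)
        ≈⟨ Σ-pairs-cong N1 (λ j k → sym (pairTerm≈ j k)) ⟩
      Σ-pairs N1 (λ j k → pairTerm i l (j , k))
        ≈⟨ sym (Σ-N1choose2 (pairTerm i l)) ⟩
      Σ N1choose2 (pairTerm i l) ∎
      where
      s₁ = Σ N1 (λ j → a i j * (z j * a l j))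
      s₂ = Σ N1 (λ j → a i j * (z j * α j))
      s₃ = Σ N1 (λ k → α k * (z k * a l k))
      g : Fin n → Fin n → Carrier
      g j k = (a i j - α j * α k * a i k) * ((z j * z k) * (a l j - α j * α k * a l k))
      pairTerm≈ : ∀ j k → pairTerm i l (j , k) ≈ g j k * w
      pairTerm≈ j k = trans (*-cong (A'-pair i j k) (*-congˡ (A'-pair l j k)))
        (solve 9 (λ bj bk cj ck aj ak zj zk w →
           (bj :- aj :* ak :* bk) :* (((zj :* zk) :* w) :* (cj :- aj :* ak :* ck))
           := ((bj :- aj :* ak :* bk) :* ((zj :* zk) :* (cj :- aj :* ak :* ck))) :* w)
           refl (a i j) (a i k) (a l j) (a l k) (α j) (α k) (z j) (z k) w)

  lhs≈rhs-if-N1-short : length N1 < 2 → lhs ≈ rhs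
  lhs≈rhs-if-N1-short short = lhs≈rhs-by-multiplier μ cleared reduced
    where
    μ : Fin m → Carrier
    μ i = - Σ N1 (λ j → a i j * α j)

    cleared : ∀ i → M (inject₁ i) r + μ i * y ≈ 0#
    cleared i = begin
      M (inject₁ i) r + μ i * y
        ≈⟨ +-cong (M-lastColumn i) (sym (-‿distribˡ-* _ y)) ⟩
      Σ N1 (λ j → a i j * (z j * α j)) - Σ N1 (λ j → a i j * α j) * y
        ≈⟨ +-congˡ (-‿cong (Σ-*-short N1 short _ z)) ⟩
      Σ N1 (λ j → a i j * (z j * α j)) - Σ N1 (λ j → a i j * α j * z j)
        ≈⟨ +-congˡ (-‿cong (Σ-cong N1 (λ j → solve 3 (λ b a z → b :* a :* z := b :* (z :* a)) refl (a i j) (α j) (z j)))) ⟩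
      Σ N1 (λ j → a i j * (z j * α j)) - Σ N1 (λ j → a i j * (z j * α j))
        ≈⟨ -‿inverseʳ _ ⟩
      0# ∎

    reduced : ∀ i l → Σ N1 (λ j → a i j * (z j * a l j)) + μ i * M r (inject₁ l) ≈ Σ N1choose2 (pairTerm i l)
    reduced i l = begin
      Σ N1 (λ j → a i j * (z j * a l j)) + μ i * M r (inject₁ l)
        ≈⟨ +-congˡ (trans (sym (-‿distribˡ-* _ _)) (-‿cong (*-congˡ (M-lastRow l)))) ⟩
      Σ N1 (λ j → a i j * (z j * a l j)) - Σ N1 (λ j → a i j * α j) * Σ N1 (λ j → α j * (z j * a l j))
        ≈⟨ +-congˡ (-‿cong (Σ-*-short N1 short _ _)) ⟩
      Σ N1 (λ j → a i j * (z j * a l j)) - Σ N1 (λ j → a i j * α j * (α j * (z j * a l j)))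
        ≈⟨ trans (+-congˡ (sym (Σ-neg N1 _))) (sym (Σ-+ N1 _ _)) ⟩
      Σ N1 (λ j → a i j * (z j * a l j) - a i j * α j * (α j * (z j * a l j)))
        ≈⟨ Σ-cong-All (on-N1 (λ {j} j∈N1 → trans
             (solve 4 (λ b c α z → b :* (z :* c) :- b :* α :* (α :* (z :* c)) := (b :* (z :* c)) :* (con (+ 1) :- α :* α))
                refl (a i j) (a l j) (α j) (z j))
             (trans (*-congˡ (1-x≈0 (α²≈1 j∈N1))) (zeroʳ _)))) ⟩
      Σ N1 (λ _ → 0#)
        ≈⟨ Σ-zero N1 ⟩
      0#
        ≈⟨ sym (trans (Σ-N1choose2 (pairTerm i l)) (Σ-pairs-short N1 short _)) ⟩
      Σ N1choose2 (pairTerm i l) ∎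

  lhs≈rhs : ¬ y ≈ 0# ⊎ length N1 < 2 → lhs ≈ rhs
  lhs≈rhs (inj₁ y≉0)   = lhs≈rhs-if-y≉0 y≉0
  lhs≈rhs (inj₂ short) = lhs≈rhs-if-N1-short short

proposition8 : {c ℓ : Level} (F : Field c ℓ) → FieldOps.CharZero F →
    (m n : ℕ) (A : Fin (Data.Nat.suc m) → Fin n → ℤ) → (∀ i j → IsSignEntry (A i j)) →
    (z : Fin n → Field.Carrier F) →
    ¬ (Field._≈_ F (FieldOps.StarMesh.y F m n A z) (Field.0# F)) ⊎ length (FieldOps.StarMesh.N1 F m n A z) < 2 →
    Field._≈_ F (FieldOps.StarMesh.lhs F m n A z) (FieldOps.StarMesh.rhs F m n A z)
proposition8 F charZero m n A A-sign z = StarMeshProof.lhs≈rhs F (charZero 1) m n A A-sign z
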